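{- Let $r=\langle L\leftarrow K\rightarrow R\rangle$ be a rule and let $r\!\downarrow=\langle L\leftarrow K'\rightarrow R\rangle$ be its normal form, where $K'=(V_K,\emptyset,\emptyset,\emptyset,\emptyset,\emptyset,\emptyset)$ is the graph with node set $V_K$, no edges, no node labels and undefined rootedness everywhere. Then for all TLRGs $G,H$: $G\Rightarrow_r H$ if and only if $G\Rightarrow_{r\downarrow} H$.
   Context: Fix a label alphabet $\mathcal{L}=(\mathcal{L}_V,\mathcal{L}_E)$ of finite sets. A graph over $\mathcal{L}$ is $G=(V,E,s,t,l,m,p)$ with finite $V,E$, total $s,t:E\to V$, partial node labelling $l:V\to\mathcal{L}_V$, total edge labelling $m:E\to\mathcal{L}_E$, partial rootedness $p:V\to\{0,1\}$ ($1$ = root). A TLRG is a graph with $l,p$ total. A morphism is a pair $(g_V,g_E)$ preserving sources, targets, edge labels, node labels where defined in the domain and rootedness where defined in the domain. $K$ is a subgraph of $G$ iff $V_K\subseteq V_G$, $E_K\subseteq E_G$, structure and edge labels are restrictions, $l_K\subseteq l_G$, $p_K\subseteq p_G$. A rule $\langle L\leftarrow K\rightarrow R\rangle$: TLRGs $L,R$ and a graph $K$ that is a subgraph of both. For a TLRG $G$ and injective $g:L\to G$ satisfying the dangling condition (no edge of $G$ outside $g(L)$ is incident to a node of $g(V_L\setminus V_K)$): delete the images of the nodes and edges of $L$ not in $K$; for $v\in V_K$ unlabelled (resp. of undefined rootedness) in $K$ make $g_V(v)$ unlabelled (resp. of undefined rootedness), giving $D$; add disjointly the nodes and edges of $R$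 not in $K$ with their labels and rootedness and give each such $g_V(v)$ label $l_R(v)$ (resp. rootedness $p_R(v)$), giving $H$. $G\Rightarrow_r M$ means $M\cong H$ for some such application. -}

module Defs where

open import Data.Nat using (ℕ)
open import Data.Fin using (Fin)
open import Data.Fin.Properties using (any?; _≟_)
open import Data.Bool using (Bool; not; T)
open import Data.Maybe using (Maybe; just; nothing; Is-just)
open import Data.Product using (Σ; ∃; _×_; _,_; proj₁; proj₂)
open import Data.Sum using (_⊎_; inj₁; inj₂)
open import Data.Unit using (tt)
open import Data.Empty using (⊥; ⊥-elim)
open import Function using (_∘_)
open import Function.Bundles using (_↔_; Inverse)
open import Function.Definitions using (Injective)
open import Relation.Nullary using (¬_; Dec; yes; no; does)
open import Relation.Nullary.Decidable.Core using (_×-dec_; ¬?)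
open import Relation.Binary.PropositionalEquality using (_≡_; _≢_; refl; sym; trans; cong)

keep : ∀ {P : Set} → Dec P → Bool
keep d = not (does d)

keep→¬ : ∀ {P : Set} (d : Dec P) → T (keep d) → ¬ P
keep→¬ (yes p) ()
keep→¬ (no ¬p) _ = ¬p

¬→keep : ∀ {P : Set} (d : Dec P) → ¬ P → T (keep d)
¬→keep (yes p) ¬p = ⊥-elim (¬p p)
¬→keep (no _) _ = tt

module Graphs (LV LE : Set) where

  -- graph structure on a node type V and an edge type E;
  -- partial functions are modelled with Maybe (nothing = undefined)
  record GraphOn (V E : Set) : Set where
    field
      s t : E → V
      l   : V → Maybe LV
      m   : E → LE
      p   : V → Maybe Bool       -- true = root (1), false = non-root (0)

  record Graph : Set where
    field
      nV nE : ℕ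
      gr    : GraphOn (Fin nV) (Fin nE)
    open GraphOn gr public

  TLRG : Graph → Set
  TLRG G = (∀ v → Is-just (Graph.l G v)) × (∀ v → Is-just (Graph.p G v))

  record Morphism (A B : Graph) : Set where
    private
      module A = Graph A
      module B = Graph B
    field
      fV : Fin A.nV → Fin B.nV
      fE : Fin A.nE → Fin B.nE
      sc : ∀ e → fV (A.s e) ≡ B.s (fE e)
      tc : ∀ e → fV (A.t e) ≡ B.t (fE e)
      mc : ∀ e → B.m (fE e) ≡ A.m e
      lc : ∀ v a → A.l v ≡ just a → B.l (fV v) ≡ just a
      pc : ∀ v b → A.p v ≡ just b → B.p (fV v) ≡ just b

  InjectiveMorphism : ∀ {A B} → Morphism A B → Set
  InjectiveMorphism f =
    Injective _≡_ _≡_ (Morphism.fV f) × Injective _≡_ _≡_ (Morphism.fE f)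

  record Iso {V E V' E' : Set} (A : GraphOn V E) (B : GraphOn V' E') : Set where
    private
      module A = GraphOn A
      module B = GraphOn B
    field
      isoV : V ↔ V'
      isoE : E ↔ E'
    open Inverse isoV renaming (to to φV)
    open Inverse isoE renaming (to to φE)
    field
      sc : ∀ e → B.s (φE e) ≡ φV (A.s e)
      tc : ∀ e → B.t (φE e) ≡ φV (A.t e)
      lc : ∀ v → B.l (φV v) ≡ A.l v
      mc : ∀ e → B.m (φE e) ≡ A.m e
      pc : ∀ v → B.p (φV v) ≡ A.p v

  -- Since graphs
  -- have nodes Fin n, "K is a subgraph of G" is represented by an
  -- injective morphism K → G (the inclusion); morphism conditions on l,p
  -- are exactly l_K ⊆ l_G, p_K ⊆ p_G.
  record Rule : Set where
    field
      L K R : Graph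
      L-tlrg : TLRG L
      R-tlrg : TLRG R
      iL : Morphism K L
      iR : Morphism K R
      iL-inj : InjectiveMorphism iL
      iR-inj : InjectiveMorphism iR

  normalForm : Rule → Rule
  normalForm r = record
    { L = L ; K = K' ; R = R ; L-tlrg = L-tlrg ; R-tlrg = R-tlrg
    ; iL = restrict iL ; iR = restrict iR
    ; iL-inj = proj₁ iL-inj , (λ {x} → ⊥-elim (noEdge x))
    ; iR-inj = proj₁ iR-inj , (λ {x} → ⊥-elim (noEdge x)) }
    where
      open Rule r
      noEdge : Fin 0 → ⊥
      noEdge ()
      K' : Graph
      K' = record { nV = Graph.nV K ; nE = 0
                  ; gr = record { s = λ () ; t = λ () ; l = λ _ → nothing
                                ; m = λ () ; p = λ _ → nothing } }
      restrict : ∀ {X} → Morphism K X → Morphism K' X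
      restrict f = record { fV = Morphism.fV f ; fE = λ ()
                          ; sc = λ () ; tc = λ () ; mc = λ ()
                          ; lc = λ _ _ () ; pc = λ _ _ () }

  Dangling : (r : Rule) (G : Graph) → Morphism (Rule.L r) G → Set
  Dangling r G g =
    ∀ (e : Fin (Graph.nE G)) → ¬ (∃ λ y → Morphism.fE g y ≡ e) →
    ∀ x → ¬ (∃ λ k → Morphism.fV (Rule.iL r) k ≡ x) →
    (Graph.s G e ≢ Morphism.fV g x) × (Graph.t G e ≢ Morphism.fV g x)

  clearIf : ∀ {A B : Set} → Maybe A → Maybe B → Maybe B
  clearIf nothing  _ = nothing
  clearIf (just _) x = x

  fillIf : ∀ {A B : Set} → Maybe A → Maybe B → Maybe B → Maybe B
  fillIf nothing  y _ = y
  fillIf (just _) _ x = x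

  module Apply (r : Rule) (G : Graph) (g : Morphism (Rule.L r) G)
               (ginj : Injective _≡_ _≡_ (Morphism.fV g))
               (dang : Dangling r G g) where
    open Rule r
    module G = Graph G
    module L = Graph L
    module K = Graph K
    module R = Graph R
    open Morphism g renaming (fV to gV; fE to gE; sc to gsc; tc to gtc)
    open Morphism iL renaming (fV to iLV; fE to iLE; sc to iLsc; tc to iLtc)
    open Morphism iR renaming (fV to iRV; fE to iRE)

    ImgLV : Fin L.nV → Set
    ImgLV x = ∃ λ k → iLV k ≡ x
    ImgLE : Fin L.nE → Set
    ImgLE y = ∃ λ k → iLE k ≡ y

    DelV : Fin G.nV → Set
    DelV v = ∃ λ x → gV x ≡ v × ¬ ImgLV x
    DelE : Fin G.nE → Set
    DelE e = ∃ λ y → gE y ≡ e × ¬ ImgLE y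

    delV? : ∀ v → Dec (DelV v)
    delV? v = any? (λ x → (gV x ≟ v) ×-dec ¬? (any? (λ k → iLV k ≟ x)))
    delE? : ∀ e → Dec (DelE e)
    delE? e = any? (λ y → (gE y ≟ e) ×-dec ¬? (any? (λ k → iLE k ≟ y)))

    VD : Set
    VD = Σ (Fin G.nV) (λ v → T (keep (delV? v)))
    ED : Set
    ED = Σ (Fin G.nE) (λ e → T (keep (delE? e)))

    noDelS : ∀ e → ¬ DelE e → ∀ x → gV x ≡ G.s e → ¬ ImgLV x → ⊥
    noDelS e ¬de x eq x∉ with any? (λ y → gE y ≟ e)
    ... | no ¬img = proj₁ (dang e ¬img x x∉) (sym eq)
    ... | yes (y , gy≡e) with any? (λ k → iLE k ≟ y)
    ...   | no y∉ = ¬de (y , gy≡e , y∉)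
    ...   | yes (ky , iky≡y) = x∉ (K.s ky , sym (ginj chain))
      where
        chain : gV x ≡ gV (iLV (K.s ky))
        chain = trans eq (trans (cong G.s (sym gy≡e)) (trans (sym (gsc y))
                  (trans (cong (gV ∘ L.s) (sym iky≡y)) (cong gV (sym (iLsc ky))))))

    noDelT : ∀ e → ¬ DelE e → ∀ x → gV x ≡ G.t e → ¬ ImgLV x → ⊥
    noDelT e ¬de x eq x∉ with any? (λ y → gE y ≟ e)
    ... | no ¬img = proj₂ (dang e ¬img x x∉) (sym eq)
    ... | yes (y , gy≡e) with any? (λ k → iLE k ≟ y)
    ...   | no y∉ = ¬de (y , gy≡e , y∉)
    ...   | yes (ky , iky≡y) = x∉ (K.t ky , sym (ginj chain))
      where
        chain : gV x ≡ gV (iLV (K.t ky))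
        chain = trans eq (trans (cong G.t (sym gy≡e)) (trans (sym (gtc y))
                  (trans (cong (gV ∘ L.t) (sym iky≡y)) (cong gV (sym (iLtc ky))))))

    sD : ED → VD
    sD (e , ke) = G.s e , ¬→keep (delV? (G.s e))
      (λ { (x , eq , x∉) → noDelS e (keep→¬ (delE? e) ke) x eq x∉ })
    tD : ED → VD
    tD (e , ke) = G.t e , ¬→keep (delV? (G.t e))
      (λ { (x , eq , x∉) → noDelT e (keep→¬ (delE? e) ke) x eq x∉ })

    inK? : ∀ v → Dec (∃ λ k → gV (iLV k) ≡ v)
    inK? v = any? (λ k → gV (iLV k) ≟ v)

    lD : VD → Maybe LV
    lD (v , _) with inK? v
    ... | yes (k , _) = clearIf (K.l k) (G.l v)
    ... | no _ = G.l v
    pD : VD → Maybe Bool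
    pD (v , _) with inK? v
    ... | yes (k , _) = clearIf (K.p k) (G.p v)
    ... | no _ = G.p v

    D : GraphOn VD ED
    D = record { s = sD ; t = tD ; l = lD ; m = λ e → G.m (proj₁ e) ; p = pD }

    imgRV? : ∀ v → Dec (∃ λ k → iRV k ≡ v)
    imgRV? v = any? (λ k → iRV k ≟ v)
    imgRE? : ∀ e → Dec (∃ λ k → iRE k ≡ e)
    imgRE? e = any? (λ k → iRE k ≟ e)

    VN : Set
    VN = Σ (Fin R.nV) (λ v → T (keep (imgRV? v)))
    EN : Set
    EN = Σ (Fin R.nE) (λ e → T (keep (imgRE? e)))

    VH : Set
    VH = VD ⊎ VN
    EH : Set
    EH = ED ⊎ EN

    keptK : ∀ k → T (keep (delV? (gV (iLV k))))
    keptK k = ¬→keep (delV? (gV (iLV k)))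
      (λ { (x , eq , x∉) → x∉ (k , sym (ginj eq)) })

    embR : Fin R.nV → VH
    embR v with imgRV? v
    ... | yes (k , _) = inj₁ (gV (iLV k) , keptK k)
    ... | no ¬q = inj₂ (v , ¬→keep (imgRV? v) ¬q)

    sH : EH → VH
    sH (inj₁ d) = inj₁ (sD d)
    sH (inj₂ (e , _)) = embR (R.s e)
    tH : EH → VH
    tH (inj₁ d) = inj₁ (tD d)
    tH (inj₂ (e , _)) = embR (R.t e)

    lH : VH → Maybe LV
    lH (inj₁ d) with inK? (proj₁ d)
    ... | yes (k , _) = fillIf (K.l k) (R.l (iRV k)) (lD d)
    ... | no _ = lD d
    lH (inj₂ (v , _)) = R.l v
    pH : VH → Maybe Bool
    pH (inj₁ d) with inK? (proj₁ d)
    ... | yes (k , _) = fillIf (K.p k) (R.p (iRV k)) (pD d)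
    ... | no _ = pD d
    pH (inj₂ (v , _)) = R.p v
    mH : EH → LE
    mH (inj₁ (e , _)) = G.m e
    mH (inj₂ (e , _)) = R.m e

    H : GraphOn VH EH
    H = record { s = sH ; t = tH ; l = lH ; m = mH ; p = pH }

  Derives : Rule → Graph → Graph → Set
  Derives r G M =
    Σ (Morphism (Rule.L r) G) λ g →
    Σ (InjectiveMorphism g) λ ginj →
    Σ (Dangling r G g) λ dang →
    Iso (Graph.gr M) (Apply.H r G g (proj₁ ginj) dang)

module Submission where

-- A rule r = ⟨L ← K → R⟩ and its normal form r↓ = ⟨L ← K' → R⟩ (K' = the
-- nodes of K, nothing else) have the same left-hand side, the same node
-- interface and hence the same matches g : L → G and dangling condition.
-- For a fixed match we compare the two results H (via r) and H↓ (via r↓):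
--   * nodes: both results have literally the same node set, and the node
--     labels/rootedness agree, because wherever K prescribes a value it is
--     preserved by L, G and R, so "keep G's value" and "take R's value" agree;
--   * edges: an edge g(k) of G with k an edge of K is kept in D by r, but
--     deleted by r↓ and re-created as the new edge iR(k) of R; all other
--     edges are handled identically.

open import Defs
open import Data.Nat using (ℕ)
open import Data.Fin using (Fin)
open import Data.Fin.Properties using (any?; _≟_)
open import Data.Bool using (Bool; true; T)
open import Data.Maybe using (Maybe; just; nothing)
open import Data.Unit using (tt)
open import Data.Empty using (⊥-elim)
open import Data.Sum using (inj₁; inj₂)
open import Data.Product using (Σ; ∃; _,_; proj₁; proj₂)
open import Function using (_∘_)
open import Function.Bundles using (_↔_; Inverse; _⇔_; mk⇔; mk↔ₛ′)
open import Function.Construct.Identity using (↔-id)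
open import Function.Construct.Symmetry using (↔-sym)
open import Function.Construct.Composition using (_↔-∘_)
open import Relation.Nullary using (¬_; Dec; yes; no)
open import Relation.Binary.PropositionalEquality
  using (_≡_; refl; sym; trans; cong; module ≡-Reasoning)

T-irrelevant : ∀ {b} (x y : T b) → x ≡ y
T-irrelevant {true} tt tt = refl

subset-≡ : ∀ {A : Set} {f : A → Bool} {a a' : A} {x : T (f a)} {y : T (f a')} →
           a ≡ a' → _≡_ {A = Σ A (T ∘ f)} (a , x) (a' , y)
subset-≡ {x = x} {y} refl = cong (_ ,_) (T-irrelevant x y)

invariant-from : ∀ {X X' Z : Set} (φ : X ↔ X') (h : X → Z) (h' : X' → Z) →
                 (∀ x → h' (Inverse.to φ x) ≡ h x) →
                 ∀ x' → h (Inverse.from φ x') ≡ h' x'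
invariant-from φ h h' inv x' =
  trans (sym (inv (from x'))) (cong h' (strictlyInverseˡ x'))
  where open Inverse φ

square-from : ∀ {X X' Y Y' : Set} (φ : X ↔ X') (ψ : Y ↔ Y')
              (h : X → Y) (h' : X' → Y') →
              (∀ x → h' (Inverse.to φ x) ≡ Inverse.to ψ (h x)) →
              ∀ x' → h (Inverse.from φ x') ≡ Inverse.from ψ (h' x')
square-from φ ψ h h' sq = invariant-from φ h (Inverse.from ψ ∘ h')
  (λ x → trans (cong (Inverse.from ψ) (sq x)) (Inverse.strictlyInverseʳ ψ (h x)))

-- Where the K-value x is defined, it must agree with both the R-value y and
-- the G-value z; then "take R's value" equals "clear G's value if x is
-- undefined, then refill it from R".
fill-after-clear : ∀ {A : Set} (x y z : Maybe A) →
                   (∀ a → x ≡ just a → y ≡ just a) →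
                   (∀ a → x ≡ just a → z ≡ just a) →
                   y ≡ Graphs.fillIf A A x y (Graphs.clearIf A A x z)
fill-after-clear nothing  y z _  _  = refl
fill-after-clear (just a) y z xy xz = trans (xy a refl) (sym (xz a refl))

module NormalForm (LV LE : Set) where
  open Graphs LV LE

  Iso-sym : ∀ {V E V' E'} {A : GraphOn V E} {B : GraphOn V' E'} → Iso A B → Iso B A
  Iso-sym {A = A} {B} i = record
    { isoV = ↔-sym isoV
    ; isoE = ↔-sym isoE
    ; sc = square-from isoE isoV A.s B.s sc
    ; tc = square-from isoE isoV A.t B.t tc
    ; lc = invariant-from isoV A.l B.l lc
    ; mc = invariant-from isoE A.m B.m mc
    ; pc = invariant-from isoV A.p B.p pc
    }
    where
      open Iso i
      module A = GraphOn A
      module B = GraphOn B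

  Iso-trans : ∀ {V E V' E' V'' E''}
                {A : GraphOn V E} {B : GraphOn V' E'} {C : GraphOn V'' E''} →
              Iso A B → Iso B C → Iso A C
  Iso-trans i j = record
    { isoV = J.isoV ↔-∘ I.isoV
    ; isoE = J.isoE ↔-∘ I.isoE
    ; sc = λ e → trans (J.sc _) (cong (Inverse.to J.isoV) (I.sc e))
    ; tc = λ e → trans (J.tc _) (cong (Inverse.to J.isoV) (I.tc e))
    ; lc = λ v → trans (J.lc _) (I.lc v)
    ; mc = λ e → trans (J.mc _) (I.mc e)
    ; pc = λ v → trans (J.pc _) (I.pc v)
    }
    where
      module I = Iso i
      module J = Iso j

  _∘ᴹ_ : ∀ {A B C} → Morphism B C → Morphism A B → Morphism A C
  g ∘ᴹ f = record
    { fV = g.fV ∘ f.fV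
    ; fE = g.fE ∘ f.fE
    ; sc = λ e → trans (cong g.fV (f.sc e)) (g.sc (f.fE e))
    ; tc = λ e → trans (cong g.fV (f.tc e)) (g.tc (f.fE e))
    ; mc = λ e → trans (g.mc (f.fE e)) (f.mc e)
    ; lc = λ v a eq → g.lc (f.fV v) a (f.lc v a eq)
    ; pc = λ v b eq → g.pc (f.fV v) b (f.pc v b eq)
    }
    where
      module f = Morphism f
      module g = Morphism g

  module ApplicationFacts (r : Rule) (G : Graph) (g : Morphism (Rule.L r) G)
                          (ginj : InjectiveMorphism g) (dang : Dangling r G g) where
    open Rule r
    open Apply r G g (proj₁ ginj) dang public
    open Morphism g public using () renaming (fV to gV; fE to gE)
    open Morphism iL public using () renaming (fV to iLV; fE to iLE)
    open Morphism iR public using () renaming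
      (fV to iRV; fE to iRE; sc to iRsc; tc to iRtc; mc to iRmc; lc to iRlc; pc to iRpc)
    module gK = Morphism (g ∘ᴹ iL)

    gK-injV : ∀ {k k'} → gV (iLV k) ≡ gV (iLV k') → k ≡ k'
    gK-injV = proj₁ iL-inj ∘ proj₁ ginj

    gK-injE : ∀ {k k'} → gE (iLE k) ≡ gE (iLE k') → k ≡ k'
    gK-injE = proj₂ iL-inj ∘ proj₂ ginj

    lD-outside : ∀ v kv → ¬ (∃ λ k → gV (iLV k) ≡ v) → lD (v , kv) ≡ G.l v
    lD-outside v kv ¬inK with inK? v
    ... | yes q = ⊥-elim (¬inK q)
    ... | no _  = refl

    pD-outside : ∀ v kv → ¬ (∃ λ k → gV (iLV k) ≡ v) → pD (v , kv) ≡ G.p v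
    pD-outside v kv ¬inK with inK? v
    ... | yes q = ⊥-elim (¬inK q)
    ... | no _  = refl

    lD-inside : ∀ k kv → lD (gV (iLV k) , kv) ≡ clearIf (K.l k) (G.l (gV (iLV k)))
    lD-inside k kv with inK? (gV (iLV k))
    ... | yes (k' , eq) rewrite gK-injV eq = refl
    ... | no ¬inK = ⊥-elim (¬inK (k , refl))

    pD-inside : ∀ k kv → pD (gV (iLV k) , kv) ≡ clearIf (K.p k) (G.p (gV (iLV k)))
    pD-inside k kv with inK? (gV (iLV k))
    ... | yes (k' , eq) rewrite gK-injV eq = refl
    ... | no ¬inK = ⊥-elim (¬inK (k , refl))

    keptE : ∀ k → T (keep (delE? (gE (iLE k))))
    keptE k = ¬→keep (delE? (gE (iLE k)))
      (λ { (y , eq , y∉) → y∉ (k , sym (proj₂ ginj eq)) })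

    data KeptEdge (e : Fin G.nE) : Set where
      untouched : ¬ (∃ λ y → gE y ≡ e) → KeptEdge e
      preserved : ∀ k → gE (iLE k) ≡ e → KeptEdge e

    keptEdge : ∀ e → T (keep (delE? e)) → KeptEdge e
    keptEdge e ke with any? (λ y → gE y ≟ e)
    ... | no ¬img = untouched ¬img
    ... | yes (y , gy≡e) with any? (λ k → iLE k ≟ y)
    ...   | yes (k , ik≡y) = preserved k (trans (cong gE ik≡y) gy≡e)
    ...   | no y∉ = ⊥-elim (keep→¬ (delE? e) ke (y , gy≡e , y∉))

    embR-preserved : ∀ k → embR (iRV k) ≡ inj₁ (gV (iLV k) , keptK k)
    embR-preserved k with imgRV? (iRV k)
    ... | yes (k' , eq) = cong inj₁ (subset-≡ (cong (gV ∘ iLV) (proj₁ iR-inj eq)))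
    ... | no ¬img = ⊥-elim (¬img (k , refl))

  module NormalFormComparison (r : Rule) (G : Graph) (g : Morphism (Rule.L r) G)
                              (ginj : InjectiveMorphism g) (dang : Dangling r G g) where
    module Ar = ApplicationFacts r G g ginj dang
    module A↓ = ApplicationFacts (normalForm r) G g ginj dang
    open Ar using (module G; module K; module R; gV; gE; iLV; iLE; iRV; iRE;
                   iRsc; iRtc; iRmc; iRlc; iRpc; untouched; preserved; keptEdge)
    open ≡-Reasoning

    allNew↓ : ∀ f → T (keep (A↓.imgRE? f))
    allNew↓ f = ¬→keep (A↓.imgRE? f) (λ { (() , _) })

    kept↓-untouched : ∀ e → T (keep (A↓.delE? e)) → ¬ (∃ λ y → gE y ≡ e)
    kept↓-untouched e ke (y , eq) = keep→¬ (A↓.delE? e) ke (y , eq , λ { (() , _) })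

    kept↓⇒kept : ∀ e → T (keep (A↓.delE? e)) → T (keep (Ar.delE? e))
    kept↓⇒kept e ke = ¬→keep (Ar.delE? e)
      (λ { (y , eq , _) → kept↓-untouched e ke (y , eq) })

    -- both rules glue R onto D in the same way (they share the node map iR)
    embR-agree : ∀ v → A↓.embR v ≡ Ar.embR v
    embR-agree v with Ar.imgRV? v
    ... | yes _ = cong inj₁ (subset-≡ refl)
    ... | no _  = cong inj₂ (subset-≡ refl)

    -- The edge bijection: an edge g(iL(k)) of D corresponds to the new edge iR(k).
    toEdge : Ar.EH → A↓.EH
    toEdge (inj₁ (e , ke)) with keptEdge e ke
    ... | untouched ¬img = inj₁ (e , ¬→keep (A↓.delE? e)
                                       (λ { (y , eq , _) → ¬img (y , eq) }))
    ... | preserved k _  = inj₂ (iRE k , allNew↓ (iRE k))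
    toEdge (inj₂ (f , _)) = inj₂ (f , allNew↓ f)

    fromNewEdge : ∀ f → Dec (∃ λ k → iRE k ≡ f) → Ar.EH
    fromNewEdge f (yes (k , _)) = inj₁ (gE (iLE k) , Ar.keptE k)
    fromNewEdge f (no ¬img)     = inj₂ (f , ¬→keep (Ar.imgRE? f) ¬img)

    fromEdge : A↓.EH → Ar.EH
    fromEdge (inj₁ (e , ke)) = inj₁ (e , kept↓⇒kept e ke)
    fromEdge (inj₂ (f , _))  = fromNewEdge f (Ar.imgRE? f)

    from∘to : ∀ x → fromEdge (toEdge x) ≡ x
    from∘to (inj₁ (e , ke)) with keptEdge e ke
    ... | untouched _ = cong inj₁ (subset-≡ refl)
    ... | preserved k eq = preserved-back (Ar.imgRE? (iRE k))
      where
        preserved-back : ∀ d → fromNewEdge (iRE k) d ≡ inj₁ (e , ke)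
        preserved-back (yes (k' , eq')) = cong inj₁ (subset-≡
          (trans (cong (gE ∘ iLE) (proj₂ (Rule.iR-inj r) eq')) eq))
        preserved-back (no ¬img) = ⊥-elim (¬img (k , refl))
    from∘to (inj₂ (f , kf)) = new-back (Ar.imgRE? f)
      where
        new-back : ∀ d → fromNewEdge f d ≡ inj₂ (f , kf)
        new-back (yes img) = ⊥-elim (keep→¬ (Ar.imgRE? f) kf img)
        new-back (no _)    = cong inj₂ (subset-≡ refl)

    to∘from : ∀ y → toEdge (fromEdge y) ≡ y
    to∘from (inj₁ (e , ke)) with keptEdge e (kept↓⇒kept e ke)
    ... | untouched _    = cong inj₁ (subset-≡ refl)
    ... | preserved k eq = ⊥-elim (kept↓-untouched e ke (iLE k , eq))
    to∘from (inj₂ (f , kf)) = new-there (Ar.imgRE? f)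
      where
        new-there : ∀ d → toEdge (fromNewEdge f d) ≡ inj₂ (f , kf)
        new-there (no _) = cong inj₂ (subset-≡ refl)
        new-there (yes (k , eq)) with keptEdge (gE (iLE k)) (Ar.keptE k)
        ... | untouched ¬img   = ⊥-elim (¬img (iLE k , refl))
        ... | preserved k' eq' = cong inj₂ (subset-≡ (trans (cong iRE (Ar.gK-injE eq')) eq))

    edgeBijection : Ar.EH ↔ A↓.EH
    edgeBijection = mk↔ₛ′ toEdge fromEdge to∘from from∘to

    source : ∀ x → A↓.sH (toEdge x) ≡ Ar.sH x
    source (inj₁ (e , ke)) with keptEdge e ke
    ... | untouched _ = cong inj₁ (subset-≡ refl)
    ... | preserved k eq = begin
      A↓.embR (R.s (iRE k))      ≡⟨ cong A↓.embR (sym (iRsc k)) ⟩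
      A↓.embR (iRV (K.s k))      ≡⟨ A↓.embR-preserved (K.s k) ⟩
      inj₁ (gV (iLV (K.s k)) , _) ≡⟨ cong inj₁ (subset-≡ (trans (Ar.gK.sc k) (cong G.s eq))) ⟩
      inj₁ (Ar.sD (e , ke))      ∎
    source (inj₂ (f , _)) = embR-agree (R.s f)

    target : ∀ x → A↓.tH (toEdge x) ≡ Ar.tH x
    target (inj₁ (e , ke)) with keptEdge e ke
    ... | untouched _ = cong inj₁ (subset-≡ refl)
    ... | preserved k eq = begin
      A↓.embR (R.t (iRE k))      ≡⟨ cong A↓.embR (sym (iRtc k)) ⟩
      A↓.embR (iRV (K.t k))      ≡⟨ A↓.embR-preserved (K.t k) ⟩
      inj₁ (gV (iLV (K.t k)) , _) ≡⟨ cong inj₁ (subset-≡ (trans (Ar.gK.tc k) (cong G.t eq))) ⟩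
      inj₁ (Ar.tD (e , ke))      ∎
    target (inj₂ (f , _)) = embR-agree (R.t f)

    edgeLabel : ∀ x → A↓.mH (toEdge x) ≡ Ar.mH x
    edgeLabel (inj₁ (e , ke)) with keptEdge e ke
    ... | untouched _ = refl
    ... | preserved k eq = begin
      R.m (iRE k)          ≡⟨ iRmc k ⟩
      K.m k                ≡⟨ sym (Ar.gK.mc k) ⟩
      G.m (gE (iLE k))     ≡⟨ cong G.m eq ⟩
      G.m e                ∎
    edgeLabel (inj₂ _) = refl

    nodeLabel : ∀ x → A↓.lH x ≡ Ar.lH x
    nodeLabel (inj₂ _) = refl
    nodeLabel (inj₁ (v , kv)) with Ar.inK? v
    ... | no ¬inK = trans (A↓.lD-outside v kv ¬inK) (sym (Ar.lD-outside v kv ¬inK))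
    ... | yes (k , refl) rewrite Ar.lD-inside k kv =
          fill-after-clear (K.l k) (R.l (iRV k)) (G.l (gV (iLV k)))
                           (iRlc k) (Ar.gK.lc k)

    rootedness : ∀ x → A↓.pH x ≡ Ar.pH x
    rootedness (inj₂ _) = refl
    rootedness (inj₁ (v , kv)) with Ar.inK? v
    ... | no ¬inK = trans (A↓.pD-outside v kv ¬inK) (sym (Ar.pD-outside v kv ¬inK))
    ... | yes (k , refl) rewrite Ar.pD-inside k kv =
          fill-after-clear (K.p k) (R.p (iRV k)) (G.p (gV (iLV k)))
                           (iRpc k) (Ar.gK.pc k)

    result-iso : Iso Ar.H A↓.H
    result-iso = record
      { isoV = ↔-id Ar.VH ; isoE = edgeBijection
      ; sc = source ; tc = target ; lc = nodeLabel ; mc = edgeLabel ; pc = rootedness }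

  derives-iff : ∀ r G M → Derives r G M ⇔ Derives (normalForm r) G M
  derives-iff r G M = mk⇔
    (λ { (g , ginj , dang , i) →
           g , ginj , dang , Iso-trans i (NormalFormComparison.result-iso r G g ginj dang) })
    (λ { (g , ginj , dang , i) →
           g , ginj , dang , Iso-trans i (Iso-sym (NormalFormComparison.result-iso r G g ginj dang)) })

-- The theorem for finite label alphabets; it holds for arbitrary graphs G, H.
mainTheorem3 : (a b : ℕ) → (r : Graphs.Rule (Fin a) (Fin b))
    → (G H : Graphs.Graph (Fin a) (Fin b))
    → Graphs.TLRG (Fin a) (Fin b) G → Graphs.TLRG (Fin a) (Fin b) H
    → (Graphs.Derives (Fin a) (Fin b) r G H
       ⇔ Graphs.Derives (Fin a) (Fin b) (Graphs.normalForm (Fin a) (Fin b) r) G H)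
mainTheorem3 a b r G H _ _ = NormalForm.derives-iff (Fin a) (Fin b) r G H
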